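{- Let $k\ge 2$ and $r\ge 2$ be integers, let $n=sk$ with $s>1$ an integer, and let $L$ be an integer with $0\le L\le rn$. Let packets $p_1,\dots,p_n$ be indexed modulo $n$ (with representatives in $\{1,\dots,n\}$). For $1\le a\le k$ and $1\le b\le rs$ put $h(a,b)=a+(b-1)k$ and define the encoding $f_{b+(a-1)rs}$ by: - if $h(a,b)\le L$: $f_{b+(a-1)rs}=p_{b+(a-1)s}$; - else if $b\le s-1$: $f_{b+(a-1)rs}=p_{b+(a-1)s}+p_{b+as}$; - else if $s\le b\le rs-1$: $f_{b+(a-1)rs}=p_{b+(a-1)s}+p_{b+(a-1)s+1}$; - else ($b=rs$): $f_{b+(a-1)rs}=p_{b+(a-1)s}+p_{1+(a-1)s}$. Let $G$ be the graph representation of the coding scheme $\{f_1,\dots,f_{rn}\}$, and let $L_G$ be the number of loops of $G$. Suppose $L_G\ge 2r-1$ and $k\le L_G\le (s-1)k$. Then, with decodability taken over $GF(q)$ for $q$ even, $b_G=\delta_I(G)=2r-1$.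
   Context: Graph representation: vertices $p_1,\dots,p_n$, one edge joining $p_j,p_k$ for each encoding $p_j+p_k$ ($j\ne k$), one loop at $p_j$ for each encoding $p_j$; edges are distinguishable. A multigraph $H$ on $\{p_1,\dots,p_n\}$ is decodable over $GF(q)$ if the system of encodings corresponding to its edges determines $p_1,\dots,p_n\in GF(q)^\ell$ uniquely; otherwise undecodable. For a decodable $G=(V,E)$, $b_G$ is the smallest cardinality of a set $\mathcal L\subseteq E$ such that $(V,E\setminus\mathcal L)$ is undecodable. The incidence degree $d_I(v)$ is the number of edges incident with $v$, each loop at $v$ counting once; $\delta_I(G)=\min_v d_I(v)$. -}

module Defs where

open import Level using (0ℓ)
open import Data.Nat using (ℕ; zero; suc; _+_; _*_; _∸_; _≤_; _<_; NonZero)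
open import Data.Nat.Properties using (_≤?_; _<?_)
open import Data.Nat.DivMod using (_mod_)
open import Data.Fin using (Fin; toℕ; remQuot; _≟_)
import Data.Fin as Fin
open import Data.Fin.Subset using (Subset; _∈_; ∁; ∣_∣)
open import Data.Bool using (Bool; true; false; if_then_else_; _∨_)
open import Data.Product using (Σ; ∃; _×_; _,_)
open import Relation.Nullary using (¬_; does)
open import Relation.Binary.PropositionalEquality using (_≡_)
open import Algebra.Bundles using (CommutativeRing)

record IsGF (q : ℕ) (F : CommutativeRing 0ℓ 0ℓ) : Set where
  open CommutativeRing F renaming (_+_ to _+F_; _*_ to _*F_)
  field
    nontrivial : ¬ (1# ≈ 0#)
    inverse    : ∀ x → ¬ (x ≈ 0#) → ∃ λ y → x *F y ≈ 1#
    enum       : Fin q → Carrier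
    enum-surj  : ∀ x → ∃ λ i → enum i ≈ x
    enum-inj   : ∀ i j → enum i ≈ enum j → i ≡ j

-- Encodings / edges of the graph representation on vertices p_1..p_n
-- (0-based: Fin n).  'single j' is the encoding p_j (a loop at p_j),
-- 'pair j k' the encoding p_j + p_k (an edge joining p_j and p_k).
-- A multigraph with m distinguishable edges is a family Fin m → Enc n.

data Enc (n : ℕ) : Set where
  single : Fin n → Enc n
  pair   : Fin n → Fin n → Enc n

module _ (F : CommutativeRing 0ℓ 0ℓ) (ℓ : ℕ) where
  open CommutativeRing F renaming (_+_ to _+F_; _*_ to _*F_)

  Packets : ℕ → Set
  Packets n = Fin n → Fin ℓ → Carrier

  encode : ∀ {n} → Enc n → Packets n → Fin ℓ → Carrier
  encode (single j) p t = p j t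
  encode (pair j k) p t = p j t +F p k t

  Decodable : ∀ {n m} → (Fin m → Enc n) → Subset m → Set
  Decodable {n} G S = ∀ (p p′ : Packets n) →
    (∀ e → e ∈ S → ∀ t → encode (G e) p t ≈ encode (G e) p′ t) →
    ∀ i t → p i t ≈ p′ i t

  BreakNumberIs : ∀ {n m} → (Fin m → Enc n) → ℕ → Set
  BreakNumberIs G b =
    (∃ λ 𝓛 → ∣ 𝓛 ∣ ≡ b × ¬ Decodable G (∁ 𝓛)) ×
    (∀ 𝓛 → ¬ Decodable G (∁ 𝓛) → b ≤ ∣ 𝓛 ∣)

countF : ∀ {m} → (Fin m → Bool) → ℕ
countF {zero}  f = 0
countF {suc m} f = (if f Fin.zero then 1 else 0) + countF (λ i → f (Fin.suc i))

isLoop : ∀ {n} → Enc n → Bool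
isLoop (single _) = true
isLoop (pair _ _) = false

numLoops : ∀ {n m} → (Fin m → Enc n) → ℕ
numLoops G = countF (λ e → isLoop (G e))

incident : ∀ {n} → Fin n → Enc n → Bool
incident v (single j) = does (j ≟ v)
incident v (pair j k) = does (j ≟ v) ∨ does (k ≟ v)

-- d_I(v): number of edges incident with v, a loop counting once
incDeg : ∀ {n m} → (Fin m → Enc n) → Fin n → ℕ
incDeg G v = countF (λ e → incident v (G e))

MinIncDegIs : ∀ {n m} → (Fin m → Enc n) → ℕ → Set
MinIncDegIs G d = (∀ v → d ≤ incDeg G v) × (∃ λ v → incDeg G v ≡ d)

-- Packet p_x (x ∈ ℤ, indexed mod n) is
-- vertex (x - 1) mod n.  With a' = a-1 ∈ Fin k, b' = b-1 ∈ Fin (r*s),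
-- the encoding f_{b+(a-1)rs} has 0-based index a'*(r*s) + b', i.e.
-- the edge index set is Fin (k * (r * s)) (of size rn), and
-- remQuot (r*s) e = (a' , b').

schemeEnc : (k r s L : ℕ) .{{_ : NonZero (s * k)}} → Fin k → Fin (r * s) → Enc (s * k)
schemeEnc k r s L a′ b′ =
  if does (h ≤? L) then single (P x)                     -- p_{b+(a-1)s}
  else if does (suc b ≤? s ∸ 1) then pair (P x) (P (x + s))  -- p_{b+(a-1)s} + p_{b+as}
  else if does (suc b ≤? r * s ∸ 1) then pair (P x) (P (x + 1)) -- + p_{b+(a-1)s+1}
  else pair (P x) (P (a * s))                          -- + p_{1+(a-1)s}
  where
  a = toℕ a′
  b = toℕ b′
  h = suc a + b * k   -- h(a,b) = a + (b-1)k
  x = b + a * s       -- (b + (a-1)s) - 1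
  P : ℕ → Fin (s * k)
  P y = y mod (s * k)

schemeGraph : (k r s L : ℕ) .{{_ : NonZero (s * k)}} → Fin (k * (r * s)) → Enc (s * k)
schemeGraph k r s L e with remQuot {k} (r * s) e
... | a′ , b′ = schemeEnc k r s L a′ b′

module Submission where

-- If two packet assignments agree on all surviving encodings but differ in some coordinate,
-- the set S of vertices where they differ is nonempty and every edge crossing S (one endpoint
-- in S, or a loop at S) must have been deleted. So every cut bound is a lower bound for b_G and
-- for δ_I(G); deleting the edges at one vertex gives b_G ≤ δ_I(G), and rn edges on n vertices
-- with a loop force δ_I(G) ≤ 2r - 1. It remains to see that every proper cut has 2r - 1 edges
-- (for S = V the ≥ 2r - 1 loops suffice). Since L ≤ (s - 1) k, the columns s - 1 .. rs - 2 hold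
-- no loops and join every p_i to p_{i+1} (indices mod n) by r - 1 parallel edges, so S has an
-- exit and an entry along this cycle, crossed by 2(r - 1) edges. One more crossing edge comes
-- from a loop in column 0 (all present as k ≤ L), an edge of the last column, or an edge of the
-- first s - 1 columns; if none of these crosses S, then S contains p_{o+gs} and p_{o+(g+1)s} but
-- no first or last vertex of a block, which gives a third switch and 3(r - 1) ≥ 2r - 1 edges.

open import Defs
open import Level using (0ℓ)
open import Algebra.Bundles using (CommutativeRing)
import Algebra.Properties.Group as GroupProperties
open import Data.Bool using (Bool; true; false; if_then_else_; not; _xor_; _∨_)
open import Data.Bool.Properties using (not-¬; ¬-not) renaming (_≟_ to _≟ᵇ_)
open import Data.Fin using (Fin; zero; suc; toℕ; fromℕ; fromℕ<; _≟_; remQuot; combine)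
import Data.Fin.Properties as Fin
open import Data.Fin.Subset using (Subset; _∈_; ∁; ∣_∣)
open import Data.Fin.Subset.Properties using (_∈?_; x∈∁p⇒x∉p; x∉p⇒x∈∁p)
open import Data.List using (List; []; _∷_; length; _++_)
import Data.List as List
import Data.List.Properties as List
open import Data.List.Membership.Propositional.Properties using (∈-++⁻)
open import Data.List.Relation.Binary.Disjoint.Propositional using (Disjoint)
open import Data.List.Relation.Unary.All as All using (All; []; _∷_)
import Data.List.Relation.Unary.All.Properties as All
open import Data.List.Relation.Unary.AllPairs using ([]; _∷_)
open import Data.List.Relation.Unary.Any using (here)
open import Data.List.Relation.Unary.Unique.Propositional using (Unique)
import Data.List.Relation.Unary.Unique.Propositional.Properties as Unique
open import Data.Nat using (ℕ; zero; suc; _+_; _*_; _∸_; _≤_; _<_; z≤n; s≤s; s≤s⁻¹; _/_; _%_; NonZero)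
open import Data.Nat.DivMod
open import Data.Nat.Divisibility using (_∣_)
open import Data.Nat.Properties hiding (_≟_)
import Data.Nat.Properties as ℕ
open import Data.Nat.Tactic.RingSolver using (solve-∀)
open import Data.Product using (∃; _×_; _,_; proj₁; proj₂; uncurry; map₂)
open import Data.Sum using (_⊎_; inj₁; inj₂)
open import Data.Vec using (_∷_; []; lookup; tabulate)
open import Data.Vec.Properties using ([]=⇒lookup; lookup⇒[]=; lookup∘tabulate)
open import Function using (_∘_)
open import Relation.Binary.Definitions using (tri<; tri≈; tri>)
open import Relation.Binary.PropositionalEquality
open import Relation.Nullary using (¬_; Dec; does; yes; no; contradiction)
open import Relation.Nullary.Decidable using (dec-true)
open import Algebra.Properties.CommutativeMonoid.Sum +-0-commutativeMonoid
  using (sum-syntax; sum-cong-≗; ∑-distrib-+; ∑-comm)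

indicator : Bool → ℕ
indicator b = if b then 1 else 0

countF≡∑ : ∀ {m} (P : Fin m → Bool) → countF P ≡ ∑[ i < m ] indicator (P i)
countF≡∑ {zero}  P = refl
countF≡∑ {suc m} P = cong (indicator (P zero) +_) (countF≡∑ (P ∘ suc))

∑-mono-≤ : ∀ {m} {f g : Fin m → ℕ} → (∀ i → f i ≤ g i) → ∑[ i < m ] f i ≤ ∑[ i < m ] g i
∑-mono-≤ {zero}  f≤g = z≤n
∑-mono-≤ {suc m} f≤g = +-mono-≤ (f≤g zero) (∑-mono-≤ (f≤g ∘ suc))

∑-const : ∀ m c → ∑[ i < m ] c ≡ m * c
∑-const zero    c = refl
∑-const (suc m) c = cong (c +_) (∑-const m c)

countF-cong : ∀ {m} {P Q : Fin m → Bool} → (∀ i → P i ≡ Q i) → countF P ≡ countF Q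
countF-cong {m} {P} {Q} P≗Q =
  trans (countF≡∑ P) (trans (sum-cong-≗ (cong indicator ∘ P≗Q)) (sym (countF≡∑ Q)))

countF-mono : ∀ {m} {P Q : Fin m → Bool} → (∀ i → P i ≡ true → Q i ≡ true) → countF P ≤ countF Q
countF-mono {m} {P} {Q} P⇒Q = begin
  countF P                     ≡⟨ countF≡∑ P ⟩
  ∑[ i < m ] indicator (P i)   ≤⟨ ∑-mono-≤ (λ i → indicator-mono (P i) (Q i) (P⇒Q i)) ⟩
  ∑[ i < m ] indicator (Q i)   ≡⟨ countF≡∑ Q ⟨
  countF Q                     ∎
  where
  open ≤-Reasoning
  indicator-mono : ∀ a b → (a ≡ true → b ≡ true) → indicator a ≤ indicator b
  indicator-mono false b _   = z≤n
  indicator-mono true  b a⇒b rewrite a⇒b refl = ≤-refl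

countF-const-true : ∀ m → countF {m} (λ _ → true) ≡ m
countF-const-true zero    = refl
countF-const-true (suc m) = cong suc (countF-const-true m)

_─_ : ∀ {m} → (Fin m → Bool) → Fin m → Fin m → Bool
(P ─ x) i = if does (i ≟ x) then false else P i

countF-─ : ∀ {m} (P : Fin m → Bool) {x} → P x ≡ true → countF P ≡ suc (countF (P ─ x))
countF-─ {suc m} P {zero}  Px rewrite Px = refl
countF-─ {suc m} P {suc x} Px =
  trans (cong (indicator (P zero) +_) (countF-─ (P ∘ suc) Px)) (+-suc (indicator (P zero)) _)

─-true : ∀ {m} (P : Fin m → Bool) {x e} → P e ≡ true → e ≢ x → (P ─ x) e ≡ true
─-true P {x} {e} Pe e≢x with e ≟ x
... | yes e≡x = contradiction e≡x e≢x
... | no  _   = Pe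

length≤countF : ∀ {m} (P : Fin m → Bool) (xs : List (Fin m)) → Unique xs →
                All (λ e → P e ≡ true) xs → length xs ≤ countF P
length≤countF P []       _          _          = z≤n
length≤countF P (x ∷ xs) (x∉xs ∷ u) (Px ∷ Pxs) = begin
  suc (length xs)       ≤⟨ s≤s (length≤countF (P ─ x) xs u (All.zipWith deleted (x∉xs , Pxs))) ⟩
  suc (countF (P ─ x))  ≡⟨ countF-─ P Px ⟨
  countF P              ∎
  where
  open ≤-Reasoning
  deleted : ∀ {y} → x ≢ y × P y ≡ true → (P ─ x) y ≡ true
  deleted (x≢y , Py) = ─-true P Py (x≢y ∘ sym)

countF-≤-injection : ∀ {m m′} (P : Fin m → Bool) (Q : Fin m′ → Bool) (f : ∀ e → P e ≡ true → Fin m′) →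
  (∀ e p → Q (f e p) ≡ true) → (∀ e e′ p p′ → f e p ≡ f e′ p′ → e ≡ e′) → countF P ≤ countF Q
countF-≤-injection {zero}  P Q f Qf f-inj = z≤n
countF-≤-injection {suc m} P Q f Qf f-inj with P zero in P0
... | false = countF-≤-injection (P ∘ suc) Q (f ∘ suc) (Qf ∘ suc)
                (λ e e′ p p′ eq → Fin.suc-injective (f-inj _ _ p p′ eq))
... | true  = begin
  suc (countF (P ∘ suc))       ≤⟨ s≤s (countF-≤-injection (P ∘ suc) (Q ─ f zero P0) (f ∘ suc)
                                    (λ e p → ─-true Q (Qf (suc e) p) (λ eq → 0≢suc (f-inj _ _ P0 p (sym eq))))
                                    (λ e e′ p p′ eq → Fin.suc-injective (f-inj _ _ p p′ eq))) ⟩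
  suc (countF (Q ─ f zero P0)) ≡⟨ countF-─ Q (Qf zero P0) ⟨
  countF Q                     ∎
  where
  open ≤-Reasoning
  0≢suc : ∀ {e : Fin m} → zero ≢ suc e
  0≢suc ()

∣∣≡countF : ∀ {m} (p : Subset m) → ∣ p ∣ ≡ countF (lookup p)
∣∣≡countF []          = refl
∣∣≡countF (true ∷ p)  = cong suc (∣∣≡countF p)
∣∣≡countF (false ∷ p) = ∣∣≡countF p

∣tabulate∣≡countF : ∀ {m} (P : Fin m → Bool) → ∣ tabulate P ∣ ≡ countF P
∣tabulate∣≡countF P = trans (∣∣≡countF (tabulate P)) (countF-cong (lookup∘tabulate P))

countF≤∣∣ : ∀ {m} (P : Fin m → Bool) (p : Subset m) → (∀ e → P e ≡ true → e ∈ p) → countF P ≤ ∣ p ∣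
countF≤∣∣ P p P⊆p = ≤-trans (countF-mono (λ e → []=⇒lookup ∘ P⊆p e)) (≤-reflexive (sym (∣∣≡countF p)))

crosses : ∀ {n} → (Fin n → Bool) → Enc n → Bool
crosses S (single j) = S j
crosses S (pair j k) = S j xor S k

cutSize : ∀ {n m} → (Fin m → Enc n) → (Fin n → Bool) → ℕ
cutSize G S = countF (λ e → crosses S (G e))

CutBound : ∀ {n m} → (Fin m → Enc n) → ℕ → Set
CutBound G b = ∀ S u → S u ≡ true → b ≤ cutSize G S

cutBound⇒≤incDeg : ∀ {n m} (G : Fin m → Enc n) {b} → CutBound G b → ∀ v → b ≤ incDeg G v
cutBound⇒≤incDeg G cut v =
  ≤-trans (cut (λ w → does (w ≟ v)) v (dec-true (v ≟ v) refl)) (countF-mono (λ e → crosses⇒incident (G e)))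
  where
  crosses⇒incident : ∀ x → crosses (λ w → does (w ≟ v)) x ≡ true → incident v x ≡ true
  crosses⇒incident (single j) c = c
  crosses⇒incident (pair j k) c with does (j ≟ v) | does (k ≟ v)
  ... | true  | _     = refl
  ... | false | true  = refl
  ... | false | false = c

countF-≟ : ∀ {n} (j : Fin n) → countF (λ v → does (j ≟ v)) ≡ 1
countF-≟ {suc n} zero    = cong suc (countF-zero≟suc (λ v → v))
  where
  countF-zero≟suc : ∀ {m} (f : Fin m → Fin n) → countF (λ v → does (zero ≟ suc (f v))) ≡ 0
  countF-zero≟suc {zero}  f = refl
  countF-zero≟suc {suc m} f = countF-zero≟suc (f ∘ suc)
countF-≟ {suc n} (suc j) = countF-≟ j

countF-∨ : ∀ {m} (P Q : Fin m → Bool) → countF (λ i → P i ∨ Q i) ≤ countF P + countF Q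
countF-∨ {m} P Q = begin
  countF (λ i → P i ∨ Q i)                                ≡⟨ countF≡∑ (λ i → P i ∨ Q i) ⟩
  ∑[ i < m ] indicator (P i ∨ Q i)                        ≤⟨ ∑-mono-≤ (λ i → indicator-∨ (P i) (Q i)) ⟩
  ∑[ i < m ] (indicator (P i) + indicator (Q i))          ≡⟨ ∑-distrib-+ (indicator ∘ P) (indicator ∘ Q) ⟩
  ∑[ i < m ] indicator (P i) + ∑[ i < m ] indicator (Q i) ≡⟨ cong₂ _+_ (countF≡∑ P) (countF≡∑ Q) ⟨
  countF P + countF Q                                     ∎
  where
  open ≤-Reasoning
  indicator-∨ : ∀ a b → indicator (a ∨ b) ≤ indicator a + indicator b
  indicator-∨ false b = ≤-refl
  indicator-∨ true  b = s≤s z≤n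

incident+isLoop≤2 : ∀ {n} (x : Enc n) → countF (λ v → incident v x) + indicator (isLoop x) ≤ 2
incident+isLoop≤2 (single j) = ≤-reflexive (cong (_+ 1) (countF-≟ j))
incident+isLoop≤2 (pair j k) = begin
  countF (λ v → does (j ≟ v) ∨ does (k ≟ v)) + 0                 ≡⟨ +-identityʳ _ ⟩
  countF (λ v → does (j ≟ v) ∨ does (k ≟ v))                     ≤⟨ countF-∨ (λ v → does (j ≟ v)) (λ v → does (k ≟ v)) ⟩
  countF (λ v → does (j ≟ v)) + countF (λ v → does (k ≟ v))      ≡⟨ cong₂ _+_ (countF-≟ j) (countF-≟ k) ⟩
  2                                                              ∎
  where open ≤-Reasoning

handshake : ∀ {n m} (G : Fin m → Enc n) → ∑[ v < n ] incDeg G v + numLoops G ≤ m * 2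
handshake {n} {m} G = begin
  ∑[ v < n ] incDeg G v + numLoops G
    ≡⟨ cong₂ _+_ (sum-cong-≗ (λ v → countF≡∑ (λ e → incident v (G e)))) (countF≡∑ (λ e → isLoop (G e))) ⟩
  ∑[ v < n ] ∑[ e < m ] indicator (incident v (G e)) + ∑[ e < m ] indicator (isLoop (G e))
    ≡⟨ cong (_+ ∑[ e < m ] indicator (isLoop (G e))) (∑-comm (λ v e → indicator (incident v (G e)))) ⟩
  ∑[ e < m ] ∑[ v < n ] indicator (incident v (G e)) + ∑[ e < m ] indicator (isLoop (G e))
    ≡⟨ ∑-distrib-+ (λ e → ∑[ v < n ] indicator (incident v (G e))) (λ e → indicator (isLoop (G e))) ⟨
  ∑[ e < m ] (∑[ v < n ] indicator (incident v (G e)) + indicator (isLoop (G e)))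
    ≤⟨ ∑-mono-≤ (λ e → subst (λ c → c + indicator (isLoop (G e)) ≤ 2)
                              (countF≡∑ (λ v → incident v (G e))) (incident+isLoop≤2 (G e))) ⟩
  ∑[ e < m ] 2
    ≡⟨ ∑-const m 2 ⟩
  m * 2 ∎
  where open ≤-Reasoning

-- With at least one loop the degree sum is below 2m ≤ n (d + 1), so some degree is at most d.
∃incDeg≤ : ∀ {n m} (G : Fin m → Enc n) d → 1 ≤ numLoops G → m * 2 ≤ n * suc d → ∃ λ v → incDeg G v ≤ d
∃incDeg≤ {n} {m} G d loop 2m≤n[d+1] with Fin.any? (λ v → incDeg G v ≤? d)
... | yes small = small
... | no  ¬small = contradiction (handshake G) (<⇒≱ (begin-strict
  m * 2                                 ≤⟨ 2m≤n[d+1] ⟩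
  n * suc d                             ≡⟨ ∑-const n (suc d) ⟨
  ∑[ v < n ] suc d                      ≤⟨ ∑-mono-≤ (λ v → ≰⇒> (¬small ∘ (v ,_))) ⟩
  ∑[ v < n ] incDeg G v                 <⟨ m<m+n _ loop ⟩
  ∑[ v < n ] incDeg G v + numLoops G    ∎))
  where open ≤-Reasoning

module _ (F : CommutativeRing 0ℓ 0ℓ) {q} (gf : IsGF q F) where
  open CommutativeRing F using (_≈_; 0#; 1#; +-group; +-congˡ)
    renaming (_+_ to _+F_; +-comm to +F-comm; refl to ≈-refl; sym to ≈-sym; trans to ≈-trans; reflexive to ≈-reflexive)
  open IsGF gf

  -- Decidability of '≈' is what lets the cut argument below form the set of
  -- vertices on which two packet assignments disagree.
  ≈-dec : ∀ x y → Dec (x ≈ y)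
  ≈-dec x y with enum-surj x | enum-surj y
  ... | i , i≈x | j , j≈y with i ≟ j
  ... | yes refl = yes (≈-trans (≈-sym i≈x) j≈y)
  ... | no  i≢j  = no (λ x≈y → i≢j (enum-inj i j (≈-trans i≈x (≈-trans x≈y (≈-sym j≈y)))))

  +-cancelʳ : ∀ {x y z w} → x +F z ≈ y +F w → z ≈ w → x ≈ y
  +-cancelʳ {x} {y} {z} x+z≈y+w z≈w =
    GroupProperties.∙-cancelʳ +-group z x y (≈-trans x+z≈y+w (+-congˡ (≈-sym z≈w)))

  module _ {n} ℓ (p p′ : Packets F ℓ n) (t : Fin ℓ) where

    disagree : Fin n → Bool
    disagree v = not (does (≈-dec (p v t) (p′ v t)))

    disagree-false : ∀ {v} → disagree v ≡ false → p v t ≈ p′ v t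
    disagree-false {v} _ with ≈-dec (p v t) (p′ v t)
    ... | yes eq = eq

    disagree-true : ∀ {v} → disagree v ≡ true → ¬ (p v t ≈ p′ v t)
    disagree-true {v} _ with ≈-dec (p v t) (p′ v t)
    ... | no ne = ne

    crosses-disagree⇒≉ : ∀ x → crosses disagree x ≡ true → ¬ (encode F ℓ x p t ≈ encode F ℓ x p′ t)
    crosses-disagree⇒≉ (single j) c = disagree-true c
    crosses-disagree⇒≉ (pair j k) c eq with disagree j in dj | disagree k in dk
    crosses-disagree⇒≉ (pair j k) () eq | true  | true
    crosses-disagree⇒≉ (pair j k) c  eq | true  | false =
      disagree-true dj (+-cancelʳ eq (disagree-false dk))
    crosses-disagree⇒≉ (pair j k) c  eq | false | true  =
      disagree-true dk (+-cancelʳ (≈-trans (+F-comm _ _) (≈-trans eq (+F-comm _ _))) (disagree-false dj))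
    crosses-disagree⇒≉ (pair j k) () eq | false | false

  cutBound⇒≤breakSet : ∀ {n m} ℓ (G : Fin m → Enc n) {b} → CutBound G b →
    ∀ 𝓛 → ¬ Decodable F ℓ G (∁ 𝓛) → b ≤ ∣ 𝓛 ∣
  cutBound⇒≤breakSet {n} ℓ G {b} cut 𝓛 undecodable with b ≤? ∣ 𝓛 ∣
  ... | yes b≤∣𝓛∣ = b≤∣𝓛∣
  ... | no  b≰∣𝓛∣ = contradiction decodable undecodable
    where
    decodable : Decodable F ℓ G (∁ 𝓛)
    decodable p p′ agree i t with ≈-dec (p i t) (p′ i t)
    ... | yes eq = eq
    ... | no  ne = contradiction (≤-trans (cut S i Si) (countF≤∣∣ _ 𝓛 crossing⇒∈𝓛)) b≰∣𝓛∣
      where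
      S : Fin n → Bool
      S = disagree ℓ p p′ t
      Si : S i ≡ true
      Si with ≈-dec (p i t) (p′ i t)
      ... | yes eq = contradiction eq ne
      ... | no  _  = refl
      crossing⇒∈𝓛 : ∀ e → crosses S (G e) ≡ true → e ∈ 𝓛
      crossing⇒∈𝓛 e c with e ∈? 𝓛
      ... | yes e∈𝓛 = e∈𝓛
      ... | no  e∉𝓛 = contradiction (agree e (x∉p⇒x∈∁p e∉𝓛) t) (crosses-disagree⇒≉ ℓ p p′ t (G e) c)

  -- Deleting every edge at 'v' leaves the packet at 'v' free: p = 0 and p′ = 1 at 'v' agree elsewhere.
  deleteIncident⇒undecodable : ∀ {n m} ℓ (G : Fin m → Enc n) → 1 ≤ ℓ → ∀ v →
    ¬ Decodable F ℓ G (∁ (tabulate (λ e → incident v (G e))))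
  deleteIncident⇒undecodable {n} (suc ℓ) G _ v decodable =
    nontrivial (≈-sym (≈-trans (decodable p p′ agree v zero) (≈-reflexive (cong (if_then 1# else 0#) (dec-true (v ≟ v) refl)))))
    where
    p p′ : Packets F (suc ℓ) n
    p  _ _ = 0#
    p′ w _ = if does (w ≟ v) then 1# else 0#
    agree-off-v : ∀ x → incident v x ≡ false → ∀ t → encode F (suc ℓ) x p t ≈ encode F (suc ℓ) x p′ t
    agree-off-v (single j) off t rewrite off = ≈-refl
    agree-off-v (pair j k) off t with does (j ≟ v) | does (k ≟ v)
    agree-off-v (pair j k) () t | true  | _
    agree-off-v (pair j k) () t | false | true
    agree-off-v (pair j k) _  t | false | false = ≈-refl
    agree : ∀ e → e ∈ ∁ (tabulate (λ e → incident v (G e))) →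
            ∀ t → encode F (suc ℓ) (G e) p t ≈ encode F (suc ℓ) (G e) p′ t
    agree e e∉ with incident v (G e) in inc
    ... | false = agree-off-v (G e) inc
    ... | true  = contradiction (lookup⇒[]= e _ (trans (lookup∘tabulate _ e) inc)) (x∈∁p⇒x∉p e∉)

  cutBound⇒breakNumberIs×minIncDegIs : ∀ {n m} ℓ (G : Fin m → Enc n) {b} → 1 ≤ ℓ →
    CutBound G b → 1 ≤ numLoops G → m * 2 ≤ n * suc b →
    BreakNumberIs F ℓ G b × MinIncDegIs G b
  cutBound⇒breakNumberIs×minIncDegIs {n} ℓ G {b} 1≤ℓ cut loop 2m≤n[b+1] =
    ( ( tabulate (λ e → incident v (G e))
        , trans (∣tabulate∣≡countF (λ e → incident v (G e))) incDeg-v≡b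
        , deleteIncident⇒undecodable ℓ G 1≤ℓ v)
      , cutBound⇒≤breakSet ℓ G cut)
    , (cutBound⇒≤incDeg G cut , v , incDeg-v≡b)
    where
    small : ∃ λ v → incDeg G v ≤ b
    small = ∃incDeg≤ G b loop 2m≤n[b+1]
    v : Fin n
    v = proj₁ small
    incDeg-v≡b : incDeg G v ≡ b
    incDeg-v≡b = ≤-antisym (proj₂ small) (cutBound⇒≤incDeg G cut v)

switch-between : (f : ℕ → Bool) {b : Bool} (a d : ℕ) → f a ≡ b → f (a + d) ≡ not b →
  ∃ λ i → a ≤ i × i < a + d × f i ≡ b × f (i + 1) ≡ not b
switch-between f {b} a zero    fa≡b fd≡¬b =
  contradiction (trans (cong f (sym (+-identityʳ a))) fd≡¬b) (not-¬ fa≡b)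
switch-between f {b} a (suc d) fa≡b fd≡¬b with f (a + 1) ≟ᵇ b
... | no  fa+1≢b = a , ≤-refl , m<m+n a (s≤s z≤n) , fa≡b , ¬-not fa+1≢b
... | yes fa+1≡b with switch-between f (a + 1) d fa+1≡b (trans (cong f (+-assoc a 1 d)) fd≡¬b)
...   | i , a+1≤i , i<a+1+d , fi , fi+1 =
  i , ≤-trans (m≤m+n a 1) a+1≤i , subst (i <_) (+-assoc a 1 d) i<a+1+d , fi , fi+1

length-++³ : ∀ {A : Set} (xs ys zs : List A) → length (xs ++ ys ++ zs) ≡ length xs + (length ys + length zs)
length-++³ xs ys zs = trans (List.length-++ xs) (cong (length xs +_) (List.length-++ ys))

disjoint-++ʳ : ∀ {A : Set} {xs ys zs : List A} → Disjoint xs ys → Disjoint xs zs → Disjoint xs (ys ++ zs)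
disjoint-++ʳ {ys = ys} xs#ys xs#zs (v∈xs , v∈ys++zs) with ∈-++⁻ ys v∈ys++zs
... | inj₁ v∈ys = xs#ys (v∈xs , v∈ys)
... | inj₂ v∈zs = xs#zs (v∈xs , v∈zs)

¬∃true⇒false : ∀ {k} {f : Fin k → Bool} → ¬ (∃ λ g → f g ≡ true) → ∀ g → f g ≡ false
¬∃true⇒false ¬∃ g = ¬-not (¬∃ ∘ (g ,_))

if-dec-yes : ∀ {p} {P : Set p} {A : Set} (d : Dec P) {x y : A} → P → (if does d then x else y) ≡ x
if-dec-yes (yes _) _ = refl
if-dec-yes (no ¬p) p = contradiction p ¬p

if-dec-no : ∀ {p} {P : Set p} {A : Set} (d : Dec P) {x y : A} → ¬ P → (if does d then x else y) ≡ y
if-dec-no (yes p) ¬p = contradiction p ¬p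
if-dec-no (no _)  _  = refl

module CodingScheme (k₀ r₀ s₀ L : ℕ) where

  k₁ r₁ s₁ k r s n m : ℕ
  k₁ = suc k₀
  r₁ = suc r₀
  s₁ = suc s₀
  k  = suc k₁
  r  = suc r₁
  s  = suc s₁
  n  = s * k
  m  = k * (r * s)

  G : Fin m → Enc n
  G = schemeGraph k r s L

  packet : ℕ → Fin n
  packet y = y mod n

  toℕ-packet : ∀ y → toℕ (packet y) ≡ y % n
  toℕ-packet y = Fin.toℕ-fromℕ< _

  packet-% : ∀ x y → x % n ≡ y % n → packet x ≡ packet y
  packet-% x y eq = Fin.toℕ-injective (trans (toℕ-packet x) (trans eq (sym (toℕ-packet y))))

  packet-%⁻ : ∀ x y → packet x ≡ packet y → x % n ≡ y % n
  packet-%⁻ x y eq = trans (sym (toℕ-packet x)) (trans (cong toℕ eq) (toℕ-packet y))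

  packet-+ : ∀ {x y} c → packet x ≡ packet y → packet (x + c) ≡ packet (y + c)
  packet-+ {x} {y} c eq = packet-% (x + c) (y + c) (begin
    (x + c) % n                ≡⟨ %-distribˡ-+ x c n ⟩
    (x % n + c % n) % n        ≡⟨ cong (λ z → (z + c % n) % n) (packet-%⁻ x y eq) ⟩
    (y % n + c % n) % n        ≡⟨ %-distribˡ-+ y c n ⟨
    (y + c) % n                ∎)
    where open ≡-Reasoning

  packet-shift : ∀ {x y} q t → x + q * n ≡ y + t * n → packet x ≡ packet y
  packet-shift {x} {y} q t eq =
    packet-% x y (trans (sym ([m+kn]%n≡m%n x q n)) (trans (cong (_% n) eq) ([m+kn]%n≡m%n y t n)))

  packet-%n : ∀ y → packet (y % n) ≡ packet y
  packet-%n y = packet-% (y % n) y (m%n%n≡m%n y n)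

  packet-+n : ∀ y → packet (y + n) ≡ packet y
  packet-+n y = packet-% (y + n) y ([m+n]%n≡m%n y n)

  packet-toℕ : ∀ (u : Fin n) → packet (toℕ u) ≡ u
  packet-toℕ u = Fin.toℕ-injective (trans (toℕ-packet (toℕ u)) (m<n⇒m%n≡m (Fin.toℕ<n u)))

  packet-injective : ∀ {x y} → x < n → y < n → packet x ≡ packet y → x ≡ y
  packet-injective {x} {y} x<n y<n eq = begin
    x      ≡⟨ m<n⇒m%n≡m x<n ⟨
    x % n  ≡⟨ packet-%⁻ x y eq ⟩
    y % n  ≡⟨ m<n⇒m%n≡m y<n ⟩
    y      ∎
    where open ≡-Reasoning

  -- Row 'a' and column 'b' of an edge index (the paper's a - 1 and b - 1).
  row : Fin m → Fin k
  row e = proj₁ (remQuot {k} (r * s) e)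

  columnFin : Fin m → Fin (r * s)
  columnFin e = proj₂ (remQuot {k} (r * s) e)

  column : Fin m → ℕ
  column e = toℕ (columnFin e)

  G≡schemeEnc : ∀ e → G e ≡ schemeEnc k r s L (row e) (columnFin e)
  G≡schemeEnc e with remQuot {k} (r * s) e
  ... | _ = refl

  G-combine : ∀ a b → G (combine a b) ≡ schemeEnc k r s L a b
  G-combine a b = trans (G≡schemeEnc (combine a b)) (cong (uncurry (schemeEnc k r s L)) (Fin.remQuot-combine {k} a b))

  column-combine : ∀ a (b : Fin (r * s)) → column (combine a b) ≡ toℕ b
  column-combine a b = cong (toℕ ∘ proj₂) (Fin.remQuot-combine {k} a b)

  -- The index b + (a - 1) s of the first endpoint of edge (a, b), before reduction mod n.
  origin : Fin k → Fin (r * s) → ℕ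
  origin a b = toℕ b + toℕ a * s

  module _ (a : Fin k) (b : Fin (r * s)) where

    schemeEnc-loop : suc (toℕ a) + toℕ b * k ≤ L → schemeEnc k r s L a b ≡ single (packet (origin a b))
    schemeEnc-loop h≤L = if-dec-yes (suc (toℕ a) + toℕ b * k ≤? L) h≤L

    schemeEnc-skip : ¬ (suc (toℕ a) + toℕ b * k ≤ L) → suc (toℕ b) ≤ s₁ →
      schemeEnc k r s L a b ≡ pair (packet (origin a b)) (packet (origin a b + s))
    schemeEnc-skip h≰L b<s₁ =
      trans (if-dec-no (suc (toℕ a) + toℕ b * k ≤? L) h≰L) (if-dec-yes (suc (toℕ b) ≤? s₁) b<s₁)

    schemeEnc-step : ¬ (suc (toℕ a) + toℕ b * k ≤ L) → s₁ ≤ toℕ b → suc (toℕ b) ≤ s₁ + r₁ * s →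
      schemeEnc k r s L a b ≡ pair (packet (origin a b)) (packet (origin a b + 1))
    schemeEnc-step h≰L s₁≤b b<rs-1 =
      trans (if-dec-no (suc (toℕ a) + toℕ b * k ≤? L) h≰L)
      (trans (if-dec-no (suc (toℕ b) ≤? s₁) (≤⇒≯ s₁≤b))
             (if-dec-yes (suc (toℕ b) ≤? s₁ + r₁ * s) b<rs-1))

    schemeEnc-close : ¬ (suc (toℕ a) + toℕ b * k ≤ L) → toℕ b ≡ s₁ + r₁ * s →
      schemeEnc k r s L a b ≡ pair (packet (origin a b)) (packet (toℕ a * s))
    schemeEnc-close h≰L b≡rs-1 =
      trans (if-dec-no (suc (toℕ a) + toℕ b * k ≤? L) h≰L)
      (trans (if-dec-no (suc (toℕ b) ≤? s₁) (≤⇒≯ (subst (s₁ ≤_) (sym b≡rs-1) (m≤m+n s₁ _))))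
             (if-dec-no (suc (toℕ b) ≤? s₁ + r₁ * s) (λ b<rs-1 → <-irrefl b≡rs-1 b<rs-1)))

    schemeEnc-firstColumns : suc (toℕ b) ≤ s₁ →
      schemeEnc k r s L a b ≡ single (packet (origin a b)) ⊎
      schemeEnc k r s L a b ≡ pair (packet (origin a b)) (packet (origin a b + s))
    schemeEnc-firstColumns b<s₁ with suc (toℕ a) + toℕ b * k ≤? L
    ... | yes h≤L = inj₁ (schemeEnc-loop h≤L)
    ... | no  h≰L = inj₂ (schemeEnc-skip h≰L b<s₁)

    schemeEnc-isLoop : isLoop (schemeEnc k r s L a b) ≡ true → suc (toℕ a) + toℕ b * k ≤ L
    schemeEnc-isLoop loop with suc (toℕ a) + toℕ b * k ≤? L
    ... | yes h≤L = h≤L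
    ... | no  h≰L = contradiction (trans (sym loop) (trans (cong isLoop (if-dec-no (suc (toℕ a) + toℕ b * k ≤? L) h≰L))
                      (if-pair (does (suc (toℕ b) ≤? s₁)) (if-pair (does (suc (toℕ b) ≤? s₁ + r₁ * s)) refl)))) λ ()
      where
      if-pair : ∀ c {j j′ : Fin n} {y} → isLoop y ≡ false → isLoop (if c then pair j j′ else y) ≡ false
      if-pair true  _ = refl
      if-pair false y = y

  s₁≤column⇒h≰L : ∀ a b → s₁ ≤ b → L ≤ s₁ * k → ¬ (suc a + b * k ≤ L)
  s₁≤column⇒h≰L a b s₁≤b L≤s₁k h≤L =
    <⇒≱ (s≤s (≤-trans (*-monoˡ-≤ k s₁≤b) (m≤n+m (b * k) a))) (≤-trans h≤L L≤s₁k)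

  toℕ-mod+/ : ∀ x → toℕ (x mod k) + x / k * k ≡ x
  toℕ-mod+/ x = trans (cong (_+ x / k * k) (Fin.toℕ-fromℕ< _)) (sym (m≡m%n+[m/n]*n x k))

  -- Row g - t modulo k, written with k - 1 ≡ -1 to avoid truncated subtraction.
  rowBack : ℕ → ℕ → Fin k
  rowBack g t = (g + k₁ * t) mod k

  packet-rowBack : ∀ g t o → packet (t * s + o + toℕ (rowBack g t) * s) ≡ packet (o + g * s)
  packet-rowBack g t o = packet-shift Q t (begin
    t * s + o + A * s + Q * n        ≡⟨ collect s k t o A Q ⟩
    t * s + o + (A + Q * k) * s      ≡⟨ cong (λ z → t * s + o + z * s) (toℕ-mod+/ (g + k₁ * t)) ⟩
    t * s + o + (g + k₁ * t) * s     ≡⟨ cancel s k₁ t o g ⟩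
    o + g * s + t * n                ∎)
    where
    open ≡-Reasoning
    A Q : ℕ
    A = toℕ (rowBack g t)
    Q = (g + k₁ * t) / k
    collect : ∀ s k t o A Q → t * s + o + A * s + Q * (s * k) ≡ t * s + o + (A + Q * k) * s
    collect = solve-∀
    cancel : ∀ s k₁ t o g → t * s + o + (g + k₁ * t) * s ≡ o + g * s + t * (s * suc k₁)
    cancel = solve-∀

  packet-nextRow : ∀ g o → packet (o + g * s + s) ≡ packet (o + toℕ ((g + 1) mod k) * s)
  packet-nextRow g o = packet-shift 0 Q (begin
    o + g * s + s + 0 * n       ≡⟨ collect s k o g ⟩
    o + (g + 1) * s             ≡⟨ cong (λ z → o + z * s) (toℕ-mod+/ (g + 1)) ⟨
    o + (A + Q * k) * s         ≡⟨ expand s k o A Q ⟩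
    o + A * s + Q * n           ∎)
    where
    open ≡-Reasoning
    A Q : ℕ
    A = toℕ ((g + 1) mod k)
    Q = (g + 1) / k
    collect : ∀ s k o g → o + g * s + s + 0 * (s * k) ≡ o + (g + 1) * s
    collect = solve-∀
    expand : ∀ s k o A Q → o + (A + Q * k) * s ≡ o + A * s + Q * (s * k)
    expand = solve-∀

  offset block : ℕ → ℕ
  offset i = i % n % s
  block  i = i % n / s

  offset<s : ∀ i → offset i < s
  offset<s i = m%n<n (i % n) s

  block<k : ∀ i → block i < k
  block<k i = m<n*o⇒m/o<n (subst (i % n <_) (*-comm s k) (m%n<n i n))

  packet-offset+block : ∀ i → packet (offset i + block i * s) ≡ packet i
  packet-offset+block i = trans (cong packet (sym (m≡m%n+[m/n]*n (i % n) s))) (packet-%n i)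

  -- Vertex o + g s has an edge to its successor in column t s + o of row g - t whenever
  -- s - 1 ≤ t s + o ≤ r s - 2; the j-th such t is 'layer o j'.
  layer : ℕ → ℕ → ℕ
  layer o j with o ℕ.≟ s₁
  ... | yes _ = j
  ... | no  _ = suc j

  s₁≤layer : ∀ o j → s₁ ≤ layer o j * s + o
  s₁≤layer o j with o ℕ.≟ s₁
  ... | yes refl = m≤n+m s₁ (j * s)
  ... | no  _    = ≤-trans (n≤1+n s₁) (≤-trans (m≤m+n s (j * s)) (m≤m+n (s + j * s) o))

  layer<rs-1 : ∀ o j → o < s → j < r₁ → suc (layer o j * s + o) ≤ s₁ + r₁ * s
  layer<rs-1 o j o<s j<r₁ with o ℕ.≟ s₁
  ... | yes refl = begin
    suc (j * s + s₁)   ≡⟨ +-suc (j * s) s₁ ⟨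
    j * s + s          ≡⟨ +-comm (j * s) s ⟩
    suc j * s          ≤⟨ *-monoˡ-≤ s j<r₁ ⟩
    r₁ * s             ≤⟨ m≤n+m (r₁ * s) s₁ ⟩
    s₁ + r₁ * s        ∎
    where open ≤-Reasoning
  ... | no  o≢s₁ = begin
    suc (suc j * s + o)  ≡⟨ +-suc (suc j * s) o ⟨
    suc j * s + suc o    ≤⟨ +-mono-≤ (*-monoˡ-≤ s j<r₁) (≤∧≢⇒< (s≤s⁻¹ o<s) o≢s₁) ⟩
    r₁ * s + s₁          ≡⟨ +-comm (r₁ * s) s₁ ⟩
    s₁ + r₁ * s          ∎
    where open ≤-Reasoning

  layer-injective : ∀ o {j j′} → layer o j ≡ layer o j′ → j ≡ j′
  layer-injective o eq with o ℕ.≟ s₁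
  ... | yes _ = eq
  ... | no  _ = suc-injective eq

  <rs : ∀ {x} → suc x ≤ s₁ + r₁ * s → x < r * s
  <rs = m≤n⇒m≤1+n

  InMiddle : Fin m → Set
  InMiddle e = s₁ ≤ column e × suc (column e) ≤ s₁ + r₁ * s

  OffMiddle : Fin m → Set
  OffMiddle e = column e < s₁ ⊎ column e ≡ s₁ + r₁ * s

  offMiddle⇒¬inMiddle : ∀ {e} → OffMiddle e → ¬ InMiddle e
  offMiddle⇒¬inMiddle (inj₁ c<s₁)    (s₁≤c , _) = ≤⇒≯ s₁≤c c<s₁
  offMiddle⇒¬inMiddle (inj₂ c≡rs-1) (_ , c<rs-1) = <-irrefl c≡rs-1 c<rs-1

  record Switch (S : Fin n → Bool) (b : Bool) (i : ℕ) : Set where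
    constructor switch
    field
      before : S (packet i) ≡ b
      after  : S (packet (i + 1)) ≡ not b

  switch-exists : ∀ {S b} (u v : Fin n) → S u ≡ b → S v ≡ not b → ∃ (Switch S b)
  switch-exists {S} {b} u v Su Sv =
    map₂ (λ { (_ , _ , Si , Si+1) → switch Si Si+1 })
      (switch-between (S ∘ packet) (toℕ u) (toℕ v + n ∸ toℕ u) (trans (cong S (packet-toℕ u)) Su) (trans (cong S around) Sv))
    where
    around : packet (toℕ u + (toℕ v + n ∸ toℕ u)) ≡ v
    around = trans (cong packet (m+[n∸m]≡n (≤-trans (<⇒≤ (Fin.toℕ<n u)) (m≤n+m n (toℕ v)))))
                   (trans (packet-+n (toℕ v)) (packet-toℕ v))

  SwitchInBlock : (Fin n → Bool) → Bool → ℕ → Set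
  SwitchInBlock S b g = ∃ λ i → g * s ≤ i × i < g * s + s × Switch S b i

  switch-inBlock : ∀ {S b} g {o o′} → o ≤ o′ → o′ < s →
    S (packet (o + g * s)) ≡ b → S (packet (o′ + g * s)) ≡ not b →
    SwitchInBlock S b g
  switch-inBlock {S} g {o} {o′} o≤o′ o′<s So So′ =
    map₂ (λ { (lo , hi , Si , Si+1) → ≤-trans (m≤n+m (g * s) o) lo , ≤-trans hi end<gs+s , switch Si Si+1 })
      (switch-between (S ∘ packet) (o + g * s) (o′ ∸ o) So (trans (cong (S ∘ packet) end) So′))
    where
    end : o + g * s + (o′ ∸ o) ≡ o′ + g * s
    end = trans (+-assoc o (g * s) _) (trans (cong (o +_) (+-comm (g * s) _))
            (trans (sym (+-assoc o (o′ ∸ o) (g * s))) (cong (_+ g * s) (m+[n∸m]≡n o≤o′))))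
    end<gs+s : o + g * s + (o′ ∸ o) ≤ g * s + s
    end<gs+s = ≤-trans (≤-reflexive end) (≤-trans (≤-reflexive (+-comm o′ (g * s))) (+-monoʳ-≤ (g * s) (<⇒≤ o′<s)))

  blockEnd≤ : ∀ {g g′} → g < g′ → g * s + s ≤ g′ * s
  blockEnd≤ {g} g<g′ = ≤-trans (≤-reflexive (+-comm (g * s) s)) (*-monoˡ-≤ s g<g′)

  block-unique : ∀ {g g′ i} → g * s ≤ i → i < g * s + s → g′ * s ≤ i → i < g′ * s + s → g ≡ g′
  block-unique {g} {g′} lo hi lo′ hi′ with <-cmp g g′
  ... | tri≈ _ g≡g′ _ = g≡g′
  ... | tri< g<g′ _ _ = contradiction (≤-trans (blockEnd≤ g<g′) lo′) (<⇒≱ hi)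
  ... | tri> _ _ g>g′ = contradiction (≤-trans (blockEnd≤ g>g′) lo) (<⇒≱ hi′)

  inBlock<n : ∀ (g : Fin k) {i} → i < toℕ g * s + s → i < n
  inBlock<n g hi = ≤-trans hi (≤-trans (blockEnd≤ (Fin.toℕ<n g)) (≤-reflexive (*-comm k s)))

  -- The only place where k ≥ 2 is needed.
  nextRow≢ : ∀ (g : Fin k) → toℕ g ≢ toℕ ((toℕ g + 1) mod k)
  nextRow≢ g eq = contradiction k≡1 λ ()
    where
    k≡1 : k ≡ 1
    k≡1 = m*n≡1⇒n≡1 ((toℕ g + 1) / k) k (+-cancelˡ-≡ (toℕ g) _ _
            (trans (cong (_+ (toℕ g + 1) / k * k) eq) (toℕ-mod+/ (toℕ g + 1))))

  module Edges (L≤s₁k : L ≤ s₁ * k) (k≤L : k ≤ L) where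

    G-middle : ∀ g t o (b : Fin (r * s)) → toℕ b ≡ t * s + o → s₁ ≤ toℕ b → suc (toℕ b) ≤ s₁ + r₁ * s →
      G (combine (rowBack g t) b) ≡ pair (packet (o + g * s)) (packet (o + g * s + 1))
    G-middle g t o b b≡ts+o s₁≤b b<rs-1 =
      trans (G-combine (rowBack g t) b)
      (trans (schemeEnc-step (rowBack g t) b (s₁≤column⇒h≰L _ (toℕ b) s₁≤b L≤s₁k) s₁≤b b<rs-1)
             (cong₂ pair position (packet-+ {toℕ b + toℕ (rowBack g t) * s} {o + g * s} 1 position)))
      where
      position : packet (toℕ b + toℕ (rowBack g t) * s) ≡ packet (o + g * s)
      position = trans (cong (λ z → packet (z + toℕ (rowBack g t) * s)) b≡ts+o) (packet-rowBack g t o)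

    parallelColumn : ℕ → Fin r₁ → Fin (r * s)
    parallelColumn i j = fromℕ< (<rs (layer<rs-1 (offset i) (toℕ j) (offset<s i) (Fin.toℕ<n j)))

    toℕ-parallelColumn : ∀ i j → toℕ (parallelColumn i j) ≡ layer (offset i) (toℕ j) * s + offset i
    toℕ-parallelColumn i j = Fin.toℕ-fromℕ< _

    parallel : ℕ → Fin r₁ → Fin m
    parallel i j = combine (rowBack (block i) (layer (offset i) (toℕ j))) (parallelColumn i j)

    column-parallel : ∀ i j → column (parallel i j) ≡ layer (offset i) (toℕ j) * s + offset i
    column-parallel i j =
      trans (column-combine (rowBack (block i) (layer (offset i) (toℕ j))) (parallelColumn i j)) (toℕ-parallelColumn i j)

    parallel-inMiddle : ∀ i j → InMiddle (parallel i j)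
    parallel-inMiddle i j rewrite column-parallel i j =
      s₁≤layer (offset i) (toℕ j) , layer<rs-1 _ _ (offset<s i) (Fin.toℕ<n j)

    G-parallel : ∀ i j → G (parallel i j) ≡ pair (packet i) (packet (i + 1))
    G-parallel i j =
      trans (G-middle (block i) _ (offset i) (parallelColumn i j) (toℕ-parallelColumn i j) s₁≤b b<rs-1)
            (cong₂ pair (packet-offset+block i) (packet-+ {offset i + block i * s} {i} 1 (packet-offset+block i)))
      where
      s₁≤b : s₁ ≤ toℕ (parallelColumn i j)
      s₁≤b = subst (s₁ ≤_) (sym (toℕ-parallelColumn i j)) (s₁≤layer (offset i) (toℕ j))
      b<rs-1 : suc (toℕ (parallelColumn i j)) ≤ s₁ + r₁ * s
      b<rs-1 = subst (λ c → suc c ≤ s₁ + r₁ * s) (sym (toℕ-parallelColumn i j)) (layer<rs-1 _ _ (offset<s i) (Fin.toℕ<n j))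

    parallel-injective : ∀ i {j j′} → parallel i j ≡ parallel i j′ → j ≡ j′
    parallel-injective i {j} {j′} eq = Fin.toℕ-injective (layer-injective (offset i)
      (*-cancelʳ-≡ _ _ s (+-cancelʳ-≡ _ _ _
        (trans (sym (column-parallel i j)) (trans (cong column eq) (column-parallel i j′))))))

    firstColumn : Fin (r * s)
    firstColumn = zero

    loopEdge : Fin k → Fin m
    loopEdge g = combine g firstColumn

    loopEdge-offMiddle : ∀ g → OffMiddle (loopEdge g)
    loopEdge-offMiddle g = inj₁ (subst (_< s₁) (sym (column-combine g firstColumn)) (s≤s z≤n))

    G-loopEdge : ∀ g → G (loopEdge g) ≡ single (packet (toℕ g * s))
    G-loopEdge g = trans (G-combine g firstColumn)
      (schemeEnc-loop g firstColumn (subst (_≤ L) (sym (+-identityʳ (suc (toℕ g)))) (≤-trans (Fin.toℕ<n g) k≤L)))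

    lastColumn : Fin (r * s)
    lastColumn = fromℕ (s₁ + r₁ * s)

    closingEdge : Fin k → Fin m
    closingEdge g = combine (rowBack (toℕ g) r₁) lastColumn

    closingEdge-offMiddle : ∀ g → OffMiddle (closingEdge g)
    closingEdge-offMiddle g = inj₂ (trans (column-combine (rowBack (toℕ g) r₁) lastColumn) (Fin.toℕ-fromℕ _))

    G-closingEdge : ∀ g → G (closingEdge g) ≡ pair (packet (s₁ + toℕ g * s)) (packet (toℕ (rowBack (toℕ g) r₁) * s))
    G-closingEdge g =
      trans (G-combine a lastColumn)
      (trans (schemeEnc-close a lastColumn (s₁≤column⇒h≰L (toℕ a) _ s₁≤b L≤s₁k) (Fin.toℕ-fromℕ _))
             (cong (λ z → pair z (packet (toℕ a * s))) position))
      where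
      a : Fin k
      a = rowBack (toℕ g) r₁
      s₁≤b : s₁ ≤ toℕ lastColumn
      s₁≤b = subst (s₁ ≤_) (sym (Fin.toℕ-fromℕ _)) (m≤m+n s₁ (r₁ * s))
      position : packet (toℕ lastColumn + toℕ a * s) ≡ packet (s₁ + toℕ g * s)
      position = trans (cong (λ z → packet (z + toℕ a * s)) (trans (Fin.toℕ-fromℕ _) (+-comm s₁ (r₁ * s))))
                       (packet-rowBack (toℕ g) r₁ s₁)

    skipColumn : ∀ o → o < s₁ → Fin (r * s)
    skipColumn o o<s₁ = fromℕ< (<rs (≤-trans o<s₁ (m≤m+n s₁ (r₁ * s))))

    toℕ-skipColumn : ∀ o o<s₁ → toℕ (skipColumn o o<s₁) ≡ o
    toℕ-skipColumn o o<s₁ = Fin.toℕ-fromℕ< _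

    skipEdge : Fin k → ∀ o → o < s₁ → Fin m
    skipEdge g o o<s₁ = combine g (skipColumn o o<s₁)

    skipEdge-offMiddle : ∀ g o o<s₁ → OffMiddle (skipEdge g o o<s₁)
    skipEdge-offMiddle g o o<s₁ =
      inj₁ (subst (_< s₁) (sym (trans (column-combine g (skipColumn o o<s₁)) (toℕ-skipColumn o o<s₁))) o<s₁)

    skipColumn<s₁ : ∀ o o<s₁ → suc (toℕ (skipColumn o o<s₁)) ≤ s₁
    skipColumn<s₁ o o<s₁ = subst (λ z → suc z ≤ s₁) (sym (toℕ-skipColumn o o<s₁)) o<s₁

    G-skipEdge : ∀ g o o<s₁ →
      G (skipEdge g o o<s₁) ≡ single (packet (o + toℕ g * s)) ⊎
      G (skipEdge g o o<s₁) ≡ pair (packet (o + toℕ g * s)) (packet (o + toℕ g * s + s))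
    G-skipEdge g o o<s₁ with schemeEnc-firstColumns g (skipColumn o o<s₁) (skipColumn<s₁ o o<s₁)
    ... | inj₁ eq = inj₁ (trans (G-combine g (skipColumn o o<s₁))
                     (trans eq (cong (λ z → single (packet (z + toℕ g * s))) (toℕ-skipColumn o o<s₁))))
    ... | inj₂ eq = inj₂ (trans (G-combine g (skipColumn o o<s₁))
                     (trans eq (cong (λ z → pair (packet (z + toℕ g * s)) (packet (z + toℕ g * s + s)))
                                     (toℕ-skipColumn o o<s₁))))

    parallels : ℕ → List (Fin m)
    parallels i = List.tabulate (parallel i)

    IsParallel : ℕ → Fin m → Set
    IsParallel i e = G e ≡ pair (packet i) (packet (i + 1)) × InMiddle e

    parallels-isParallel : ∀ i → All (IsParallel i) (parallels i)
    parallels-isParallel i = All.tabulate⁺ {f = parallel i} (λ j → G-parallel i j , parallel-inMiddle i j)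

    parallels-unique : ∀ i → Unique (parallels i)
    parallels-unique i = Unique.tabulate⁺ {f = parallel i} (parallel-injective i)

    length-parallels : ∀ i → length (parallels i) ≡ r₁
    length-parallels i = List.length-tabulate (parallel i)

    parallels-disjoint : ∀ i i′ → packet i ≢ packet i′ → Disjoint (parallels i) (parallels i′)
    parallels-disjoint i i′ i≢i′ (e∈ , e∈′) =
      i≢i′ (pair-injectiveˡ (trans (sym (proj₁ (All.lookup (parallels-isParallel i) e∈)))
                                   (proj₁ (All.lookup (parallels-isParallel i′) e∈′))))
      where
      pair-injectiveˡ : ∀ {a b c d : Fin n} → pair a b ≡ pair c d → a ≡ c
      pair-injectiveˡ refl = refl

    parallels-disjoint-offMiddle : ∀ i {e} → OffMiddle e → Disjoint (parallels i) (e ∷ [])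
    parallels-disjoint-offMiddle i {e} off (e∈ , here refl) =
      offMiddle⇒¬inMiddle {e} off (proj₂ (All.lookup (parallels-isParallel i) e∈))

    switch⇒parallels-cross : ∀ {S b} i → Switch S b i → All (λ e → crosses S (G e) ≡ true) (parallels i)
    switch⇒parallels-cross {S} {b} i (switch Si Si+1) =
      All.map (λ {e} isP → subst (λ x → crosses S x ≡ true) (sym (proj₁ isP)) crossing) (parallels-isParallel i)
      where
      crossing : crosses S (pair (packet i) (packet (i + 1))) ≡ true
      crossing rewrite Si | Si+1 = b-xor-not b
        where
        b-xor-not : ∀ b → b xor not b ≡ true
        b-xor-not true  = refl
        b-xor-not false = refl

    switches-distinct : ∀ {S} i i′ → Switch S true i → Switch S false i′ → packet i ≢ packet i′
    switches-distinct {S} i i′ (switch Si _) (switch Si′ _) eq = contradiction (trans (sym Si) (trans (cong S eq) Si′)) λ ()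

    2r∸1≡r₁+[r₁+1] : 2 * r ∸ 1 ≡ r₁ + (r₁ + 1)
    2r∸1≡r₁+[r₁+1] = arith r₁
      where
      arith : ∀ x → x + (suc x + 0) ≡ x + (x + 1)
      arith = solve-∀

    twoSwitches+edge⇒bound : ∀ {S ex en} e → Switch S true ex → Switch S false en →
      OffMiddle e → crosses S (G e) ≡ true → 2 * r ∸ 1 ≤ cutSize G S
    twoSwitches+edge⇒bound {S} {ex} {en} e exit entry off crossing = begin
      2 * r ∸ 1                                     ≡⟨ 2r∸1≡r₁+[r₁+1] ⟩
      r₁ + (r₁ + 1)                                 ≡⟨ cong₂ _+_ (length-parallels ex) (cong (_+ 1) (length-parallels en)) ⟨
      length (parallels ex) + (length (parallels en) + 1) ≡⟨ length-++³ (parallels ex) (parallels en) (e ∷ []) ⟨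
      length edges                                  ≤⟨ length≤countF _ edges unique crossings ⟩
      cutSize G S                                   ∎
      where
      open ≤-Reasoning
      edges : List (Fin m)
      edges = parallels ex ++ parallels en ++ e ∷ []
      unique : Unique edges
      unique = Unique.++⁺ (parallels-unique ex)
                 (Unique.++⁺ (parallels-unique en) ([] ∷ []) (parallels-disjoint-offMiddle en off))
                 (disjoint-++ʳ (parallels-disjoint ex en (switches-distinct ex en exit entry)) (parallels-disjoint-offMiddle ex off))
      crossings : All (λ e → crosses S (G e) ≡ true) edges
      crossings = All.++⁺ (switch⇒parallels-cross ex exit) (All.++⁺ (switch⇒parallels-cross en entry) (crossing ∷ []))

    threeSwitches⇒bound : ∀ {S y y′ z} → Switch S true y → Switch S true y′ → Switch S false z →
      packet y ≢ packet y′ → 2 * r ∸ 1 ≤ cutSize G S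
    threeSwitches⇒bound {S} {y} {y′} {z} exit exit′ entry y≢y′ = begin
      2 * r ∸ 1                                     ≡⟨ 2r∸1≡r₁+[r₁+1] ⟩
      r₁ + (r₁ + 1)                                 ≤⟨ +-monoʳ-≤ r₁ (+-monoʳ-≤ r₁ (s≤s z≤n)) ⟩
      r₁ + (r₁ + r₁)
        ≡⟨ cong₂ _+_ (length-parallels y) (cong₂ _+_ (length-parallels y′) (length-parallels z)) ⟨
      length (parallels y) + (length (parallels y′) + length (parallels z))
        ≡⟨ length-++³ (parallels y) (parallels y′) (parallels z) ⟨
      length edges                                  ≤⟨ length≤countF _ edges unique crossings ⟩
      cutSize G S                                   ∎
      where
      open ≤-Reasoning
      edges : List (Fin m)
      edges = parallels y ++ parallels y′ ++ parallels z
      unique : Unique edges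
      unique = Unique.++⁺ (parallels-unique y)
                 (Unique.++⁺ (parallels-unique y′) (parallels-unique z)
                   (parallels-disjoint y′ z (switches-distinct y′ z exit′ entry)))
                 (disjoint-++ʳ (parallels-disjoint y y′ y≢y′) (parallels-disjoint y z (switches-distinct y z exit entry)))
      crossings : All (λ e → crosses S (G e) ≡ true) edges
      crossings = All.++⁺ (switch⇒parallels-cross y exit)
                    (All.++⁺ (switch⇒parallels-cross y′ exit′) (switch⇒parallels-cross z entry))

    -- Three switches when the vertex o + g s ∈ S has its skip edge to o + (g + 1) s inside S:
    -- an entry and an exit in block g and an exit in block g + 1, since columns 0 and s - 1 avoid S.
    skipInside⇒bound : ∀ S (g : Fin k) {o} → o < s₁ →
      (∀ (g : Fin k) → S (packet (toℕ g * s)) ≡ false) → (∀ (g : Fin k) → S (packet (s₁ + toℕ g * s)) ≡ false) →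
      S (packet (o + toℕ g * s)) ≡ true → S (packet (o + toℕ g * s + s)) ≡ true → 2 * r ∸ 1 ≤ cutSize G S
    skipInside⇒bound S g {o} o<s₁ first∉S last∉S o∈S skip∈S =
      bound (switch-inBlock (toℕ g) (<⇒≤ o<s₁) ≤-refl o∈S (last∉S g))
            (switch-inBlock (toℕ g′) (<⇒≤ o<s₁) ≤-refl o∈S′ (last∉S g′))
            (switch-inBlock (toℕ g) z≤n (≤-trans o<s₁ (n≤1+n s₁)) (first∉S g) o∈S)
      where
      g′ : Fin k
      g′ = (toℕ g + 1) mod k
      o∈S′ : S (packet (o + toℕ g′ * s)) ≡ true
      o∈S′ = trans (cong S (sym (packet-nextRow (toℕ g) o))) skip∈S
      bound : SwitchInBlock S true (toℕ g) → SwitchInBlock S true (toℕ g′) → SwitchInBlock S false (toℕ g) →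
        2 * r ∸ 1 ≤ cutSize G S
      bound (y , lo , hi , exit) (y′ , lo′ , hi′ , exit′) (z , _ , _ , entry) =
        threeSwitches⇒bound exit exit′ entry y≢y′
        where
        y≢y′ : packet y ≢ packet y′
        y≢y′ eq = nextRow≢ g (block-unique lo hi (subst (_ ≤_) (sym y≡y′) lo′) (subst (_< _) (sym y≡y′) hi′))
          where
          y≡y′ : y ≡ y′
          y≡y′ = packet-injective (inBlock<n g hi) (inBlock<n g′ hi′) eq

    OffMiddleCrossing : (Fin n → Bool) → Set
    OffMiddleCrossing S = ∃ λ e → OffMiddle e × crosses S (G e) ≡ true

    offMiddleCrossing : ∀ {S} e {x} → OffMiddle e → G e ≡ x → crosses S x ≡ true → OffMiddleCrossing S
    offMiddleCrossing {S} e off Ge≡x crossing = e , off , subst (λ x → crosses S x ≡ true) (sym Ge≡x) crossing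

    crossing-pair : ∀ (S : Fin n → Bool) a b → S a ≡ true → S b ≡ false → crosses S (pair a b) ≡ true
    crossing-pair S a b Sa Sb rewrite Sa | Sb = refl

    skipEdge⊎bound : ∀ S (g : Fin k) {o} (o<s₁ : o < s₁) →
      (∀ (g : Fin k) → S (packet (toℕ g * s)) ≡ false) → (∀ (g : Fin k) → S (packet (s₁ + toℕ g * s)) ≡ false) →
      S (packet (o + toℕ g * s)) ≡ true → OffMiddleCrossing S ⊎ 2 * r ∸ 1 ≤ cutSize G S
    skipEdge⊎bound S g {o} o<s₁ first∉S last∉S o∈S with G-skipEdge g o o<s₁ | S (packet (o + toℕ g * s + s)) in skip∈S
    ... | inj₁ loop | _     = inj₁ (offMiddleCrossing (skipEdge g o o<s₁) (skipEdge-offMiddle g o o<s₁) loop o∈S)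
    ... | inj₂ edge | false = inj₁ (offMiddleCrossing (skipEdge g o o<s₁) (skipEdge-offMiddle g o o<s₁) edge
                                      (crossing-pair S _ _ o∈S skip∈S))
    ... | inj₂ _    | true  = inj₂ (skipInside⇒bound S g o<s₁ first∉S last∉S o∈S skip∈S)

    offMiddleCrossing⊎bound : ∀ S i → S (packet i) ≡ true → OffMiddleCrossing S ⊎ 2 * r ∸ 1 ≤ cutSize G S
    offMiddleCrossing⊎bound S i i∈S with Fin.any? (λ g → S (packet (toℕ g * s)) ≟ᵇ true)
    ... | yes (g , first∈S) = inj₁ (offMiddleCrossing (loopEdge g) (loopEdge-offMiddle g) (G-loopEdge g) first∈S)
    ... | no ¬first∈S with Fin.any? (λ g → S (packet (s₁ + toℕ g * s)) ≟ᵇ true)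
    ...   | yes (g , last∈S) = inj₁ (offMiddleCrossing (closingEdge g) (closingEdge-offMiddle g) (G-closingEdge g)
                                      (crossing-pair S _ _ last∈S (¬∃true⇒false {k} ¬first∈S (rowBack (toℕ g) r₁))))
    ...   | no ¬last∈S = skipEdge⊎bound S g o<s₁ (¬∃true⇒false {k} ¬first∈S) (¬∃true⇒false {k} ¬last∈S) o∈S
      where
      g : Fin k
      g = fromℕ< (block<k i)
      o : ℕ
      o = offset i
      o∈S : S (packet (o + toℕ g * s)) ≡ true
      o∈S = trans (cong (λ z → S (packet (o + z * s))) (Fin.toℕ-fromℕ< (block<k i)))
                  (trans (cong S (packet-offset+block i)) i∈S)
      o<s₁ : o < s₁
      o<s₁ = ≤∧≢⇒< (s≤s⁻¹ (offset<s i)) λ o≡s₁ →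
        contradiction (trans (sym o∈S) (trans (cong (λ z → S (packet (z + toℕ g * s))) o≡s₁) (¬∃true⇒false {k} ¬last∈S g)))
                      λ ()

    cutBound : 2 * r ∸ 1 ≤ numLoops G → CutBound G (2 * r ∸ 1)
    cutBound loops S u u∈S with Fin.any? (λ v → S v ≟ᵇ false)
    ... | no ¬v∉S = ≤-trans loops (countF-mono (λ e → loop⇒crosses (G e)))
      where
      loop⇒crosses : ∀ x → isLoop x ≡ true → crosses S x ≡ true
      loop⇒crosses (single j) _ = ¬-not (¬v∉S ∘ (j ,_))
    ... | yes (v , v∉S)
      with switch-exists u v u∈S v∉S | switch-exists v u v∉S u∈S
         | offMiddleCrossing⊎bound S (toℕ u) (trans (cong S (packet-toℕ u)) u∈S)
    ... | _ , exit | _ , entry | inj₁ (e , off , crossing) = twoSwitches+edge⇒bound e exit entry off crossing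
    ... | _        | _         | inj₂ bound                 = bound

  -- h(a, b) - 1, the position of edge (a, b) in the order in which loops are assigned.
  height : Fin m → ℕ
  height e = toℕ (row e) + column e * k

  height≡toℕ-combine : ∀ e → height e ≡ toℕ (combine (columnFin e) (row e))
  height≡toℕ-combine e = trans (+-comm (toℕ (row e)) _) (trans (cong (_+ toℕ (row e)) (*-comm (column e) k))
                           (sym (Fin.toℕ-combine (columnFin e) (row e))))

  height-injective : ∀ {e e′} → height e ≡ height e′ → e ≡ e′
  height-injective {e} {e′} eq = begin
    e                                ≡⟨ Fin.combine-remQuot {k} (r * s) e ⟨
    combine (row e) (columnFin e)    ≡⟨ cong₂ combine (proj₂ same) (proj₁ same) ⟩
    combine (row e′) (columnFin e′)  ≡⟨ Fin.combine-remQuot {k} (r * s) e′ ⟩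
    e′                               ∎
    where
    open ≡-Reasoning
    same : columnFin e ≡ columnFin e′ × row e ≡ row e′
    same = Fin.combine-injective (columnFin e) (row e) (columnFin e′) (row e′)
             (Fin.toℕ-injective (trans (sym (height≡toℕ-combine e)) (trans eq (height≡toℕ-combine e′))))

  loop⇒height<L : ∀ e → isLoop (G e) ≡ true → height e < L
  loop⇒height<L e loop = schemeEnc-isLoop (row e) (columnFin e) (trans (cong isLoop (sym (G≡schemeEnc e))) loop)

  numLoops≤L : numLoops G ≤ L
  numLoops≤L = ≤-trans
    (countF-≤-injection _ (λ (_ : Fin L) → true) (λ e loop → fromℕ< (loop⇒height<L e loop)) (λ _ _ → refl)
      (λ e e′ loop loop′ eq → height-injective
        (trans (sym (Fin.toℕ-fromℕ< _)) (trans (cong toℕ eq) (Fin.toℕ-fromℕ< _)))))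
    (≤-reflexive (countF-const-true L))

  height<L⇒loop : ∀ e → height e < L → isLoop (G e) ≡ true
  height<L⇒loop e h<L = cong isLoop (trans (G≡schemeEnc e) (schemeEnc-loop (row e) (columnFin e) h<L))

  edgeOfHeight : Fin (r * s * k) → Fin m
  edgeOfHeight j = combine (proj₂ (remQuot {r * s} k j)) (proj₁ (remQuot {r * s} k j))

  height-edgeOfHeight : ∀ j → height (edgeOfHeight j) ≡ toℕ j
  height-edgeOfHeight j = begin
    height (combine a b)          ≡⟨ cong (λ (a , b) → toℕ a + toℕ b * k) (Fin.remQuot-combine {k} a b) ⟩
    toℕ a + toℕ b * k             ≡⟨ trans (+-comm (toℕ a) _) (cong (_+ toℕ a) (*-comm (toℕ b) k)) ⟩
    k * toℕ b + toℕ a             ≡⟨ Fin.toℕ-combine b a ⟨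
    toℕ (combine b a)             ≡⟨ cong toℕ (Fin.combine-remQuot {r * s} k j) ⟩
    toℕ j                         ∎
    where
    open ≡-Reasoning
    a : Fin k
    a = proj₂ (remQuot {r * s} k j)
    b : Fin (r * s)
    b = proj₁ (remQuot {r * s} k j)

  L≤numLoops : L ≤ r * s * k → L ≤ numLoops G
  L≤numLoops L≤m = ≤-trans (≤-reflexive (sym (countF-const-true L)))
    (countF-≤-injection (λ (_ : Fin L) → true) (λ e → isLoop (G e)) (λ i _ → edgeOfHeight (below i))
      (λ i _ → height<L⇒loop (edgeOfHeight (below i)) (subst (_< L) (sym (toℕ-below i)) (Fin.toℕ<n i)))
      (λ i i′ _ _ eq → Fin.toℕ-injective (trans (sym (toℕ-below i)) (trans (cong height eq) (toℕ-below i′)))))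
    where
    below : Fin L → Fin (r * s * k)
    below i = fromℕ< (≤-trans (Fin.toℕ<n i) L≤m)
    toℕ-below : ∀ i → height (edgeOfHeight (below i)) ≡ toℕ i
    toℕ-below i = trans (height-edgeOfHeight (below i)) (Fin.toℕ-fromℕ< _)

  numLoops≡L : L ≤ r * s * k → numLoops G ≡ L
  numLoops≡L L≤m = ≤-antisym numLoops≤L (L≤numLoops L≤m)

proposition1 : (k r s L : ℕ) .{{_ : NonZero (s * k)}} →
    2 ≤ k → 2 ≤ r → 1 < s → L ≤ r * (s * k) →
    2 * r ∸ 1 ≤ numLoops (schemeGraph k r s L) →
    k ≤ numLoops (schemeGraph k r s L) →
    numLoops (schemeGraph k r s L) ≤ (s ∸ 1) * k →
    (q : ℕ) → 2 ∣ q → (F : CommutativeRing 0ℓ 0ℓ) → IsGF q F →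
    (ℓ : ℕ) → 1 ≤ ℓ →
    BreakNumberIs F ℓ (schemeGraph k r s L) (2 * r ∸ 1) ×
    MinIncDegIs (schemeGraph k r s L) (2 * r ∸ 1)
proposition1 (suc (suc k₀)) (suc (suc r₀)) (suc (suc s₀)) L (s≤s (s≤s _)) (s≤s (s≤s _)) (s≤s (s≤s _))
             L≤rn 2r-1≤loops k≤loops loops≤[s-1]k _ _ F gf ℓ 1≤ℓ =
  cutBound⇒breakNumberIs×minIncDegIs F gf ℓ G 1≤ℓ
    (Edges.cutBound (subst (_≤ s₁ * k) loops≡L loops≤[s-1]k) (subst (k ≤_) loops≡L k≤loops) 2r-1≤loops)
    (≤-trans (s≤s z≤n) 2r-1≤loops)
    (≤-reflexive (2m≡n·2r k r s))
  where
  open CodingScheme k₀ r₀ s₀ L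
  loops≡L : numLoops G ≡ L
  loops≡L = numLoops≡L (≤-trans L≤rn (≤-reflexive (sym (*-assoc r s k))))
  2m≡n·2r : ∀ k r s → k * (r * s) * 2 ≡ s * k * (2 * r)
  2m≡n·2r = solve-∀
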